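{- Let $\mathrm{M}$ be a loopless matroid of rank $r+1$ on $E$, let $\mathscr{P}$ be an order filter of nonempty proper flats, let $I\subseteq E$ and $F\in\mathscr{P}$. (1) If $|I|\ge\mathrm{rk}_\mathrm{M}(F)$, then $(\prod_{i\in I}x_i)x_F=0$ in $A^*(\mathrm{M},\mathscr{P})$. (2) If $|I|\ge r+1$, then $\prod_{i\in I}x_i=0$ in $A^*(\mathrm{M},\mathscr{P})$.
   Context: An order filter is a set $\mathscr{P}$ of nonempty proper flats with $F_1\subseteq F_2$, $F_1\in\mathscr{P}\Rightarrow F_2\in\mathscr{P}$. $A^*(\mathrm{M},\mathscr{P})$ is $\mathbb{Z}[x_i,x_F: i\in E, F\in\mathscr{P}]$ modulo the ideal generated by: $x_{F_1}x_{F_2}$ for incomparable $F_1,F_2\in\mathscr P$; $x_ix_F$ for $F\in\mathscr{P}$, $i\in E\setminus F$; $\prod_{i\in I}x_i$ for independent sets $I$ whose closure lies in $\mathscr{P}\cup\{E\}$; and $(x_i+\sum_{F\in\mathscr{P},i\in F}x_F)-(x_j+\sum_{F\in\mathscr{P},j\in F}x_F)$ for distinct $i,j\in E$. -}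

module Defs where

open import Data.Nat using (ℕ; zero; suc; _≤_; _<_; _≡ᵇ_)
open import Data.Bool using (Bool; true; false; T)
open import Data.Fin using (Fin)
open import Data.Fin.Subset using (Subset; _∈_; _∉_; _⊆_; _∪_; _∩_; ⁅_⁆; ∣_∣; ⊤; Nonempty)
open import Data.Fin.Subset.Properties using (_∈?_)
open import Data.List using (List; []; _∷_; _++_; map; foldr)
open import Data.List.Base using (allFin)
open import Data.Vec using (Vec; []; _∷_; tabulate)
open import Data.Sum using (_⊎_)
open import Data.Product using (_×_)
open import Relation.Nullary using (¬_; Dec; yes; no)
open import Relation.Nullary.Decidable using (T?)
open import Relation.Binary.PropositionalEquality using (_≡_; _≢_)

record Matroid (n : ℕ) : Set where
  field
    rk        : Subset n → ℕ
    rk-bound  : ∀ A → rk A ≤ ∣ A ∣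
    rk-mono   : ∀ {A B} → A ⊆ B → rk A ≤ rk B
    rk-submod : ∀ A B → rk (A ∪ B) Data.Nat.+ rk (A ∩ B) ≤ rk A Data.Nat.+ rk B

module _ {n : ℕ} (M : Matroid n) where
  open Matroid M

  rank : ℕ
  rank = rk ⊤

  Loopless : Set
  Loopless = ∀ (i : Fin n) → rk ⁅ i ⁆ ≡ 1

  IsFlat : Subset n → Set
  IsFlat F = ∀ (i : Fin n) → i ∉ F → rk F < rk (F ∪ ⁅ i ⁆)

  NonemptyProperFlat : Subset n → Set
  NonemptyProperFlat F = IsFlat F × Nonempty F × F ≢ ⊤

  Independent : Subset n → Set
  Independent I = rk I ≡ ∣ I ∣

  closure : Subset n → Subset n
  closure I = tabulate (λ i → rk (I ∪ ⁅ i ⁆) ≡ᵇ rk I)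

  record IsOrderFilter (P : Subset n → Bool) : Set where
    field
      members  : ∀ F → T (P F) → NonemptyProperFlat F
      up-close : ∀ F₁ F₂ → T (P F₁) → F₁ ⊆ F₂ → NonemptyProperFlat F₂ → T (P F₂)

allSubsets : (n : ℕ) → List (Subset n)
allSubsets zero    = [] ∷ []
allSubsets (suc n) = map (true ∷_) (allSubsets n) ++ map (false ∷_) (allSubsets n)

-- The ring A*(M, P) = ℤ[x_i, x_F : i ∈ E, F ∈ P] / J, presented as
-- the setoid of polynomial expressions modulo the smallest congruence
-- containing the commutative-ring axioms and (generator ≈ 0) for each
-- generator of J.

module _ {n : ℕ} (M : Matroid n) (P : Subset n → Bool) where
  open Matroid M

  data Var : Set where
    xᵢ : Fin n → Var
    xF : (F : Subset n) → T (P F) → Var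

  infixl 6 _+_ _-_
  infixl 7 _*_
  data Poly : Set where
    var     : Var → Poly
    0# 1#   : Poly
    _+_ _*_ : Poly → Poly → Poly
    -_      : Poly → Poly

  _-_ : Poly → Poly → Poly
  p - q = p + (- q)

  prodX : Subset n → Poly
  prodX I = foldr (λ i acc → step i (i ∈? I) acc) 1# (allFin n)
    where
      step : (i : Fin n) → Dec (i ∈ I) → Poly → Poly
      step i (yes _) acc = var (xᵢ i) * acc
      step i (no _)  acc = acc

  termF : (i : Fin n) → (F : Subset n) → Dec (T (P F)) → Dec (i ∈ F) → Poly
  termF i F (yes p) (yes _) = var (xF F p)
  termF i F _       _       = 0#

  linForm : Fin n → Poly
  linForm i = var (xᵢ i) + foldr (λ F acc → termF i F (T? (P F)) (i ∈? F) + acc) 0# (allSubsets n)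

  data Generator : Poly → Set where
    gen-incomp : ∀ F₁ F₂ (p₁ : T (P F₁)) (p₂ : T (P F₂)) →
                 ¬ (F₁ ⊆ F₂) → ¬ (F₂ ⊆ F₁) →
                 Generator (var (xF F₁ p₁) * var (xF F₂ p₂))
    gen-out    : ∀ F (p : T (P F)) (i : Fin n) → i ∉ F →
                 Generator (var (xᵢ i) * var (xF F p))
    gen-indep  : ∀ I → Independent M I →
                 T (P (closure M I)) ⊎ closure M I ≡ ⊤ →
                 Generator (prodX I)
    gen-lin    : ∀ (i j : Fin n) → i ≢ j →
                 Generator (linForm i - linForm j)

  infix 4 _≈_
  data _≈_ : Poly → Poly → Set where
    ≈-refl  : ∀ {a} → a ≈ a
    ≈-sym   : ∀ {a b} → a ≈ b → b ≈ a
    ≈-trans : ∀ {a b c} → a ≈ b → b ≈ c → a ≈ c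
    +-cong  : ∀ {a b c d} → a ≈ b → c ≈ d → a + c ≈ b + d
    *-cong  : ∀ {a b c d} → a ≈ b → c ≈ d → a * c ≈ b * d
    neg-cong : ∀ {a b} → a ≈ b → - a ≈ - b
    +-assoc : ∀ a b c → (a + b) + c ≈ a + (b + c)
    +-comm  : ∀ a b → a + b ≈ b + a
    +-idˡ   : ∀ a → 0# + a ≈ a
    neg-invˡ : ∀ a → (- a) + a ≈ 0#
    *-assoc : ∀ a b c → (a * b) * c ≈ a * (b * c)
    *-comm  : ∀ a b → a * b ≈ b * a
    *-idˡ   : ∀ a → 1# * a ≈ a
    distribˡ : ∀ a b c → a * (b + c) ≈ (a * b) + (a * c)
    gen≈0   : ∀ {g} → Generator g → g ≈ 0#

module Submission where

-- Both parts are instances of one vanishing criterion (module Vanishing).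
-- Let S be a flat and X a ring element such that x_J = 0 for every independent
-- J spanning S, and such that for ∣K∣ + 1 = rk S every x_G (G ∈ P) separating
-- two elements of S kills x_K · X.  Then x_I · X = 0 whenever I ⊆ S and
-- ∣I∣ ≥ rk S.  Indeed, x_I is a multiple of x_J for some J ⊆ I of size rk S.
-- If J is independent it spans S.  Otherwise J has an element i whose removal
-- keeps its rank, and S has an element j raising it; multiplying the linear
-- relation x_i + Σ_{G ∋ i} x_G = x_j + Σ_{G ∋ j} x_G by x_{J ∖ i} · X replaces
-- x_i by x_j, and (J ∖ i) ∪ {j} has larger rank, so induction on the rank
-- concludes.  Part (1) takes S = F, X = x_F (after using x_i x_F = 0 when I ⊄ F),
-- by induction on rk F: a flat G separating two elements of F is either a
-- smaller flat inside F or incomparable with F.  Part (2) takes S = E, X = 1.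

open import Defs
open import Data.Nat using (ℕ; suc; _≤_)
open import Data.Bool using (Bool; T)
open import Data.Fin.Subset using (Subset; ∣_∣)
open import Data.Product using (_×_)
open import Relation.Binary.PropositionalEquality using (_≡_)

import Data.Nat as ℕ
open import Data.Bool using (true; false)
open import Data.Nat using (zero; _<_; _<?_; z≤n; s≤s)
open import Data.Nat.Properties
  using (≤-pred; ≤-reflexive; ≤-trans; <-≤-trans; <⇒≱; ≰⇒>; ≮⇒≥; n<1+n; m≤m+n;
         m≤n⇒m<n∨m≡n; +-suc; +-mono-≤; +-monoˡ-≤; +-monoʳ-≤; +-cancelˡ-≤; +-cancelʳ-≤;
         ≡ᵇ⇒≡; ≡⇒≡ᵇ; _≤?_; module ≤-Reasoning)
import Data.Nat.Properties as ℕₚ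
open import Data.Bool.Properties using (T-≡)
open import Data.Fin using (Fin) renaming (zero to fzero; suc to fsuc)
open import Data.Fin.Properties using (any?; ¬∀⟶∃¬; _≟_)
open import Data.Fin.Subset
  using (_∈_; _∉_; _⊆_; _⊂_; _∪_; _∩_; _─_; ⁅_⁆; ⊤; ⊥)
  renaming (_-_ to _∖_)
open import Data.Fin.Subset.Properties
  using (_∈?_; _⊆?_; ∈⊤; ⊆⊤; ⊆-refl; ⊆-antisym; ⊆-min; s⊆s; ∣⊥∣≡0; nonempty?; Empty-unique;
         x∈⁅x⁆; x∈⁅y⁆⇒x≡y; x≢y⇒x∉⁅y⁆; x∉⁅y⁆⇒x≢y; p─⊥≡p; ∪-identityʳ;
         x∈p∪q⁻; p⊆p∪q; q⊆p∪q; x∈p∩q⁺; x∈p∧x≢y⇒x∈p-y;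
         x∈p∧x∉q⇒x∈p─q; x∈p⇒p-x⊂p)
open import Data.Fin.Subset.Induction using (⊂-wellFounded; Acc; acc)
open import Data.Vec using ([]; _∷_; here; there)
open import Data.Vec.Properties using (lookup∘tabulate; []=⇒lookup; lookup⇒[]=)
open import Data.Product using (Σ; ∃; ∃₂; _,_; proj₁; proj₂)
open import Data.Sum using (_⊎_; inj₁; inj₂; [_,_]′)
open import Function using (_∘_; id; Equivalence)
open import Data.List using (List; []; _∷_; foldr; allFin)
open import Data.List.Relation.Unary.All using (All; []; _∷_)
import Data.List.Relation.Unary.All as All
open import Data.List.Relation.Unary.Any using (here; there)
open import Data.List.Relation.Unary.Unique.Propositional using (Unique)
open import Data.List.Relation.Unary.AllPairs using (_∷_)
open import Data.List.Relation.Unary.Unique.Propositional.Properties using (allFin⁺)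
open import Data.List.Membership.Propositional using () renaming (_∈_ to _∈ₗ_)
open import Data.List.Membership.Propositional.Properties using (∈-allFin)
open import Relation.Nullary using (yes; no; contradiction)
open import Relation.Nullary.Decidable using (T?; _×-dec_; ¬?)
open import Level using (0ℓ)
open import Relation.Binary.Bundles using (Setoid)
open import Algebra.Bundles using (CommutativeRing)
import Algebra.Consequences.Setoid
import Algebra.Properties.Ring
import Algebra.Properties.CommutativeSemigroup
import Relation.Binary.Reasoning.Setoid
open import Relation.Binary.PropositionalEquality using (_≢_; ≢-sym; refl; sym; trans; cong; cong₂; subst)

variable
  n : ℕ

∣p∖x∣+1≡∣p∣ : ∀ (p : Subset n) {x} → x ∈ p → suc ∣ p ∖ x ∣ ≡ ∣ p ∣
∣p∖x∣+1≡∣p∣ (_ ∷ p) here = cong suc (cong ∣_∣ (p─⊥≡p p))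
∣p∖x∣+1≡∣p∣ (true ∷ p) (there x∈p) = cong suc (∣p∖x∣+1≡∣p∣ p x∈p)
∣p∖x∣+1≡∣p∣ (false ∷ p) (there x∈p) = ∣p∖x∣+1≡∣p∣ p x∈p

∣p∪⁅x⁆∣≡∣p∣+1 : ∀ (p : Subset n) {x} → x ∉ p → ∣ p ∪ ⁅ x ⁆ ∣ ≡ suc ∣ p ∣
∣p∪⁅x⁆∣≡∣p∣+1 (true ∷ p) {fzero} x∉p = contradiction here x∉p
∣p∪⁅x⁆∣≡∣p∣+1 (false ∷ p) {fzero} x∉p = cong suc (cong ∣_∣ (∪-identityʳ p))
∣p∪⁅x⁆∣≡∣p∣+1 (true ∷ p) {fsuc x} x∉p = cong suc (∣p∪⁅x⁆∣≡∣p∣+1 p (x∉p ∘ there))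
∣p∪⁅x⁆∣≡∣p∣+1 (false ∷ p) {fsuc x} x∉p = ∣p∪⁅x⁆∣≡∣p∣+1 p (x∉p ∘ there)

x∈p─q⁻ : ∀ {p q : Subset n} {x} → x ∈ p ─ q → x ∈ p × x ∉ q
x∈p─q⁻ {p = _ ∷ _} {false ∷ _} here = here , λ ()
x∈p─q⁻ {p = _ ∷ _} {true ∷ _} {fzero} ()
x∈p─q⁻ {p = _ ∷ _} {_ ∷ _} (there x∈) =
  let x∈p , x∉q = x∈p─q⁻ x∈ in there x∈p , x∉q ∘ λ { (there x∈q) → x∈q }

x∈p∖y⁻ : ∀ {p : Subset n} {x y} → x ∈ p ∖ y → x ∈ p × x ≢ y
x∈p∖y⁻ x∈ = let x∈p , x∉y = x∈p─q⁻ x∈ in x∈p , x∉⁅y⁆⇒x≢y x∉y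

x∈p∪⁅y⁆⁻ : ∀ {p : Subset n} {x y} → x ∈ p ∪ ⁅ y ⁆ → x ∈ p ⊎ x ≡ y
x∈p∪⁅y⁆⁻ {p = p} {y = y} x∈ with x∈p∪q⁻ p ⁅ y ⁆ x∈
... | inj₁ x∈p = inj₁ x∈p
... | inj₂ x∈y = inj₂ (x∈⁅y⁆⇒x≡y y x∈y)

p∪⁅y⁆⊆q : ∀ {p q : Subset n} {y} → p ⊆ q → y ∈ q → p ∪ ⁅ y ⁆ ⊆ q
p∪⁅y⁆⊆q p⊆q y∈q x∈ with x∈p∪⁅y⁆⁻ x∈
... | inj₁ x∈p = p⊆q x∈p
... | inj₂ refl = y∈q

[p∪⁅y⁆]∖y≡p : ∀ {p : Subset n} {y} → y ∉ p → (p ∪ ⁅ y ⁆) ∖ y ≡ p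
[p∪⁅y⁆]∖y≡p {p = p} {y} y∉p = ⊆-antisym ⊆p p⊆
  where
  ⊆p : (p ∪ ⁅ y ⁆) ∖ y ⊆ p
  ⊆p x∈ with x∈p∖y⁻ x∈
  ... | x∈p∪y , x≢y with x∈p∪⁅y⁆⁻ x∈p∪y
  ...   | inj₁ x∈p = x∈p
  ...   | inj₂ x≡y = contradiction x≡y x≢y
  p⊆ : p ⊆ (p ∪ ⁅ y ⁆) ∖ y
  p⊆ x∈p = x∈p∧x≢y⇒x∈p-y (p⊆p∪q _ x∈p) (λ { refl → y∉p x∈p })

-- Membership as a sum type (a case split that, unlike a 'with' on _∈?_,
-- leaves occurrences of the decision procedure in goals untouched).
∈-or-∉ : ∀ x (p : Subset n) → x ∈ p ⊎ x ∉ p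
∈-or-∉ x p with x ∈? p
... | yes x∈p = inj₁ x∈p
... | no x∉p = inj₂ x∉p

⊆-or-∉ : ∀ (p q : Subset n) → p ⊆ q ⊎ ∃ λ x → x ∈ p × x ∉ q
⊆-or-∉ p q with any? (λ x → (x ∈? p) ×-dec ¬? (x ∈? q))
... | yes witness = inj₂ witness
... | no none = inj₁ λ {x} x∈p →
  [ id , (λ x∉q → contradiction (x , x∈p , x∉q) none) ]′ (∈-or-∉ x q)

p≢⊤⇒∃∉ : ∀ {p : Subset n} → p ≢ ⊤ → ∃ λ x → x ∉ p
p≢⊤⇒∃∉ {n} {p} p≢⊤ = ¬∀⟶∃¬ n (_∈ p) (_∈? p) λ all → p≢⊤ (⊆-antisym ⊆⊤ λ {x} _ → all x)

subset-of-size : ∀ (p : Subset n) k → k ≤ ∣ p ∣ → ∃ λ q → q ⊆ p × ∣ q ∣ ≡ k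
subset-of-size {zero} [] zero _ = [] , (λ ()) , refl
subset-of-size {suc n} (true ∷ p) zero _ = ⊥ , ⊆-min _ , ∣⊥∣≡0 (suc n)
subset-of-size (true ∷ p) (suc k) (s≤s k≤) =
  let q , q⊆p , ∣q∣ = subset-of-size p k k≤ in true ∷ q , s⊆s q⊆p , cong suc ∣q∣
subset-of-size (false ∷ p) k k≤ =
  let q , q⊆p , ∣q∣ = subset-of-size p k k≤ in false ∷ q , s⊆s q⊆p , ∣q∣

remove-induction : ∀ (Q : Subset n → Set) → Q ⊥ → (∀ p x → x ∈ p → Q (p ∖ x) → Q p) → ∀ p → Q p
remove-induction Q base step p = go p (⊂-wellFounded p)
  where
  go : ∀ p → Acc _⊂_ p → Q p
  go p (acc smaller) with nonempty? p
  ... | yes (x , x∈p) = step p x x∈p (go (p ∖ x) (smaller (x∈p⇒p-x⊂p x∈p)))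
  ... | no empty = subst Q (sym (Empty-unique empty)) base

sum-≤-cancel : ∀ {a b c d} → a ℕ.+ b ≤ c ℕ.+ d → d ≤ b → a ≤ c
sum-≤-cancel {a} {b} {c} {d} sum≤ d≤b = +-cancelʳ-≤ d a c (≤-trans (+-monoʳ-≤ a d≤b) sum≤)

sum-<-cancel : ∀ {a b c d} → a ℕ.+ b ≤ c ℕ.+ d → d < a → b < c
sum-<-cancel {a} {b} {c} {d} sum≤ d<a = +-cancelˡ-≤ d (suc b) c (begin
  d ℕ.+ suc b  ≡⟨ +-suc d b ⟩
  suc d ℕ.+ b  ≤⟨ +-monoˡ-≤ b d<a ⟩
  a ℕ.+ b      ≤⟨ sum≤ ⟩
  c ℕ.+ d      ≡⟨ ℕₚ.+-comm c d ⟩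
  d ℕ.+ c      ∎)
  where open ≤-Reasoning

module Rank (M : Matroid n) where
  open Matroid M

  submodular-⊆ : ∀ {X Y} A B → X ⊆ A ∪ B → Y ⊆ A ∩ B → rk X ℕ.+ rk Y ≤ rk A ℕ.+ rk B
  submodular-⊆ A B X⊆ Y⊆ = ≤-trans (+-mono-≤ (rk-mono X⊆) (rk-mono Y⊆)) (rk-submod A B)

  flat-rank-< : ∀ {G F x} → IsFlat M G → G ⊆ F → x ∈ F → x ∉ G → rk G < rk F
  flat-rank-< flat G⊆F x∈F x∉G = <-≤-trans (flat _ x∉G) (rk-mono (p∪⁅y⁆⊆q G⊆F x∈F))

  rank-unchanged : ∀ A S → (∀ s → s ∈ S → rk (A ∪ ⁅ s ⁆) ≤ rk A) → rk (A ∪ S) ≤ rk A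
  rank-unchanged A = remove-induction Q base step
    where
    Q : Subset n → Set
    Q S = (∀ s → s ∈ S → rk (A ∪ ⁅ s ⁆) ≤ rk A) → rk (A ∪ S) ≤ rk A
    base : Q ⊥
    base _ = ≤-reflexive (cong rk (∪-identityʳ A))
    step : ∀ S s → s ∈ S → Q (S ∖ s) → Q S
    step S s s∈S ih unchanged = ≤-trans
      (sum-≤-cancel (submodular-⊆ (A ∪ (S ∖ s)) (A ∪ ⁅ s ⁆) A∪S⊆ A⊆) (unchanged s s∈S))
      (ih λ t t∈ → unchanged t (proj₁ (x∈p∖y⁻ t∈)))
      where
      A∪S⊆ : A ∪ S ⊆ (A ∪ (S ∖ s)) ∪ (A ∪ ⁅ s ⁆)
      A∪S⊆ {x} x∈ with x∈p∪q⁻ A S x∈ | x ≟ s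
      ... | inj₁ x∈A | _ = p⊆p∪q _ (p⊆p∪q _ x∈A)
      ... | inj₂ _ | yes refl = q⊆p∪q _ _ (q⊆p∪q A _ (x∈⁅x⁆ s))
      ... | inj₂ x∈S | no x≢s = p⊆p∪q _ (q⊆p∪q A _ (x∈p∧x≢y⇒x∈p-y x∈S x≢s))
      A⊆ : A ⊆ (A ∪ (S ∖ s)) ∩ (A ∪ ⁅ s ⁆)
      A⊆ x∈A = x∈p∩q⁺ (p⊆p∪q _ x∈A , p⊆p∪q _ x∈A)

  augment : ∀ A T → rk A < rk T → ∃ λ j → j ∈ T × rk A < rk (A ∪ ⁅ j ⁆)
  augment A T rkA<rkT with any? (λ j → (j ∈? T) ×-dec (rk A <? rk (A ∪ ⁅ j ⁆)))
  ... | yes found = found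
  ... | no none = contradiction
    (≤-trans (rk-mono (q⊆p∪q A T)) (rank-unchanged A T λ j j∈T → ≮⇒≥ λ raises → none (j , j∈T , raises)))
    (<⇒≱ rkA<rkT)

  coloops⇒independent : ∀ J → (∀ i → i ∈ J → rk (J ∖ i) < rk J) → ∣ J ∣ ≤ rk J
  coloops⇒independent J coloop = remove-induction Q base step J ⊆-refl
    where
    Q : Subset n → Set
    Q K = K ⊆ J → ∣ K ∣ ≤ rk K
    base : Q ⊥
    base _ = subst (_≤ rk ⊥) (sym (∣⊥∣≡0 n)) z≤n
    step : ∀ K i → i ∈ K → Q (K ∖ i) → Q K
    step K i i∈K ih K⊆J = subst (_≤ rk K) (∣p∖x∣+1≡∣p∣ K i∈K)
      (<-≤-trans (s≤s (ih (K⊆J ∘ proj₁ ∘ x∈p∖y⁻)))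
                 (sum-<-cancel (submodular-⊆ K (J ∖ i) J⊆ K∖i⊆) (coloop i (K⊆J i∈K))))
      where
      J⊆ : J ⊆ K ∪ (J ∖ i)
      J⊆ {x} x∈J with x ≟ i
      ... | yes refl = p⊆p∪q _ i∈K
      ... | no x≢i = q⊆p∪q K _ (x∈p∧x≢y⇒x∈p-y x∈J x≢i)
      K∖i⊆ : K ∖ i ⊆ K ∩ (J ∖ i)
      K∖i⊆ x∈ = let x∈K , x≢i = x∈p∖y⁻ x∈ in x∈p∩q⁺ (x∈K , x∈p∧x≢y⇒x∈p-y (K⊆J x∈K) x≢i)

  dependent⇒redundant : ∀ J → rk J < ∣ J ∣ → ∃ λ i → i ∈ J × rk J ≤ rk (J ∖ i)
  dependent⇒redundant J dependent with any? (λ i → (i ∈? J) ×-dec (rk J ≤? rk (J ∖ i)))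
  ... | yes found = found
  ... | no none = contradiction
    (coloops⇒independent J λ i i∈J → ≰⇒> λ keeps → none (i , i∈J , keeps))
    (<⇒≱ dependent)

  exchange-rank : ∀ J {i j} → i ∈ J → rk J ≤ rk (J ∖ i) → rk J < rk (J ∪ ⁅ j ⁆) →
                  rk J < rk ((J ∖ i) ∪ ⁅ j ⁆)
  exchange-rank J {i} {j} i∈J keeps raises =
    <-≤-trans raises (sum-≤-cancel (submodular-⊆ ((J ∖ i) ∪ ⁅ j ⁆) J J∪j⊆ J∖i⊆) keeps)
    where
    J∪j⊆ : J ∪ ⁅ j ⁆ ⊆ ((J ∖ i) ∪ ⁅ j ⁆) ∪ J
    J∪j⊆ = p∪⁅y⁆⊆q (q⊆p∪q _ J) (p⊆p∪q J (q⊆p∪q (J ∖ i) ⁅ j ⁆ (x∈⁅x⁆ j)))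
    J∖i⊆ : J ∖ i ⊆ ((J ∖ i) ∪ ⁅ j ⁆) ∩ J
    J∖i⊆ x∈ = x∈p∩q⁺ (p⊆p∪q ⁅ j ⁆ x∈ , proj₁ (x∈p∖y⁻ x∈))

  exchange-step : ∀ J T → rk J < rk T → rk J < ∣ J ∣ →
                  ∃₂ λ i j → i ∈ J × j ∈ T × j ∉ J × rk J < rk ((J ∖ i) ∪ ⁅ j ⁆)
  exchange-step J T rkJ<rkT dependent =
    let i , i∈J , keeps = dependent⇒redundant J dependent
        j , j∈T , raises = augment J T rkJ<rkT
        j∉J = λ j∈J → <⇒≱ raises (rk-mono (p∪⁅y⁆⊆q ⊆-refl j∈J))
    in i , j , i∈J , j∈T , j∉J , exchange-rank J i∈J keeps raises

  ∈closure⁻ : ∀ {J x} → x ∈ closure M J → rk (J ∪ ⁅ x ⁆) ≡ rk J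
  ∈closure⁻ {J} {x} x∈ = ≡ᵇ⇒≡ _ _ (Equivalence.from T-≡
    (trans (sym (lookup∘tabulate (λ y → rk (J ∪ ⁅ y ⁆) ℕ.≡ᵇ rk J) x)) ([]=⇒lookup x∈)))

  ∈closure⁺ : ∀ {J x} → rk (J ∪ ⁅ x ⁆) ≡ rk J → x ∈ closure M J
  ∈closure⁺ {J} {x} same = lookup⇒[]= x _
    (trans (lookup∘tabulate (λ y → rk (J ∪ ⁅ y ⁆) ℕ.≡ᵇ rk J) x) (Equivalence.to T-≡ (≡⇒≡ᵇ _ _ same)))

  closure-spanning : ∀ {J T} → IsFlat M T → J ⊆ T → rk J ≡ rk T → closure M J ≡ T
  closure-spanning {J} {T} flat J⊆T rkJ≡rkT = ⊆-antisym cl⊆T T⊆cl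
    where
    cl⊆T : closure M J ⊆ T
    cl⊆T {x} x∈cl with x ∈? T
    ... | yes x∈T = x∈T
    ... | no x∉T = contradiction (≤-reflexive (∈closure⁻ x∈cl)) (<⇒≱ (begin-strict
      rk J                 ≡⟨ rkJ≡rkT ⟩
      rk T                 <⟨ flat x x∉T ⟩
      rk (T ∪ ⁅ x ⁆)       ≤⟨ sum-≤-cancel (submodular-⊆ (J ∪ ⁅ x ⁆) T T∪x⊆ J⊆) (≤-reflexive (sym rkJ≡rkT)) ⟩
      rk (J ∪ ⁅ x ⁆)       ∎))
      where
      open ≤-Reasoning
      T∪x⊆ : T ∪ ⁅ x ⁆ ⊆ (J ∪ ⁅ x ⁆) ∪ T
      T∪x⊆ = p∪⁅y⁆⊆q (q⊆p∪q _ T) (p⊆p∪q T (q⊆p∪q J ⁅ x ⁆ (x∈⁅x⁆ x)))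
      J⊆ : J ⊆ (J ∪ ⁅ x ⁆) ∩ T
      J⊆ x∈J = x∈p∩q⁺ (p⊆p∪q ⁅ x ⁆ x∈J , J⊆T x∈J)
    T⊆cl : T ⊆ closure M J
    T⊆cl {x} x∈T = ∈closure⁺ (ℕₚ.≤-antisym
      (≤-trans (rk-mono (p∪⁅y⁆⊆q J⊆T x∈T)) (≤-reflexive (sym rkJ≡rkT)))
      (rk-mono (p⊆p∪q ⁅ x ⁆)))

module Quotient (M : Matroid n) (P : Subset n → Bool) where
  open Matroid M

  polySetoid : Setoid 0ℓ 0ℓ
  polySetoid = record
    { Carrier = Poly M P ; _≈_ = _≈_ M P
    ; isEquivalence = record { refl = ≈-refl ; sym = ≈-sym ; trans = ≈-trans } }

  open Algebra.Consequences.Setoid polySetoid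
    using (comm∧idˡ⇒id; comm∧invˡ⇒inv; comm∧distrˡ⇒distr)

  -- A*(M, P) is a commutative ring: Defs presents its equality as the
  -- congruence generated by (left-handed) commutative-ring laws and the relations.
  A* : CommutativeRing 0ℓ 0ℓ
  A* = record
    { Carrier = Poly M P ; _≈_ = _≈_ M P
    ; _+_ = _+_ ; _*_ = _*_ ; -_ = -_ ; 0# = 0# ; 1# = 1#
    ; isCommutativeRing = record
      { isRing = record
        { +-isAbelianGroup = record
          { isGroup = record
            { isMonoid = record
              { isSemigroup = record
                { isMagma = record
                  { isEquivalence = Setoid.isEquivalence polySetoid ; ∙-cong = +-cong }
                ; assoc = +-assoc }
              ; identity = comm∧idˡ⇒id +-comm +-idˡ }
            ; inverse = comm∧invˡ⇒inv +-comm neg-invˡ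
            ; ⁻¹-cong = neg-cong }
          ; comm = +-comm }
        ; *-cong = *-cong
        ; *-assoc = *-assoc
        ; *-identity = comm∧idˡ⇒id *-comm *-idˡ
        ; distrib = comm∧distrˡ⇒distr +-cong *-comm distribˡ }
      ; *-comm = *-comm } }

  open CommutativeRing A* public using (setoid; zeroˡ; zeroʳ; *-identityʳ; *-congˡ; *-congʳ; distribʳ)
  open Algebra.Properties.Ring (CommutativeRing.ring A*) public using (x∙y⁻¹≈ε⇒x≈y; [y-z]x≈yx-zx; +-cancelʳ)
  open Algebra.Properties.CommutativeSemigroup (CommutativeRing.*-commutativeSemigroup A*) public
    using (x∙yz≈y∙xz)
  open Relation.Binary.Reasoning.Setoid setoid public

  infix 4 _≃_
  _≃_ : Poly M P → Poly M P → Set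
  _≃_ = _≈_ M P

  -- prodX I is a right fold over the list of all elements of E whose step,
  -- local to Defs, multiplies by x_i exactly when i ∈ I; unification recovers
  -- that step as `factor I`, and the two lemmas below compute it.
  factor : Subset n → Fin n → Poly M P → Poly M P
  factor I = proj₁ prodX-as-fold
    where
    prodX-as-fold : Σ (Fin n → Poly M P → Poly M P) λ g → prodX M P I ≡ foldr g 1# (allFin n)
    prodX-as-fold = _ , refl

  factor-∈ : ∀ {I i} a → i ∈ I → factor I i a ≡ var (xᵢ i) * a
  factor-∈ {I} {i} a i∈I with i ∈? I
  ... | yes _ = refl
  ... | no i∉I = contradiction i∈I i∉I

  factor-∉ : ∀ {I i} a → i ∉ I → factor I i a ≡ a
  factor-∉ {I} {i} a i∉I with i ∈? I
  ... | yes i∈I = contradiction i∈I i∉I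
  ... | no _ = refl

  prod : Subset n → List (Fin n) → Poly M P
  prod I = foldr (factor I) 1#

  prod-split : ∀ {I J} xs → J ⊆ I → prod I xs ≃ prod J xs * prod (I ─ J) xs
  prod-split [] _ = ≈-sym (*-identityʳ 1#)
  prod-split {I} {J} (k ∷ xs) J⊆I with ∈-or-∉ k J | ∈-or-∉ k I
  ... | inj₁ k∈J | _ = begin
    factor I k (prod I xs)                        ≡⟨ factor-∈ _ (J⊆I k∈J) ⟩
    var (xᵢ k) * prod I xs                        ≈⟨ *-congˡ (prod-split xs J⊆I) ⟩
    var (xᵢ k) * (prod J xs * prod (I ─ J) xs)    ≈⟨ ≈-sym (*-assoc _ _ _) ⟩
    (var (xᵢ k) * prod J xs) * prod (I ─ J) xs    ≡⟨ cong₂ _*_ (sym (factor-∈ _ k∈J))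
                                                       (sym (factor-∉ _ λ k∈I─J → proj₂ (x∈p─q⁻ k∈I─J) k∈J)) ⟩
    factor J k (prod J xs) * factor (I ─ J) k (prod (I ─ J) xs) ∎
  ... | inj₂ k∉J | inj₁ k∈I = begin
    factor I k (prod I xs)                        ≡⟨ factor-∈ _ k∈I ⟩
    var (xᵢ k) * prod I xs                        ≈⟨ *-congˡ (prod-split xs J⊆I) ⟩
    var (xᵢ k) * (prod J xs * prod (I ─ J) xs)    ≈⟨ x∙yz≈y∙xz _ _ _ ⟩
    prod J xs * (var (xᵢ k) * prod (I ─ J) xs)    ≡⟨ cong₂ _*_ (sym (factor-∉ _ k∉J))
                                                       (sym (factor-∈ _ (x∈p∧x∉q⇒x∈p─q k∈I k∉J))) ⟩
    factor J k (prod J xs) * factor (I ─ J) k (prod (I ─ J) xs) ∎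
  ... | inj₂ k∉J | inj₂ k∉I = begin
    factor I k (prod I xs)                        ≡⟨ factor-∉ _ k∉I ⟩
    prod I xs                                     ≈⟨ prod-split xs J⊆I ⟩
    prod J xs * prod (I ─ J) xs                   ≡⟨ cong₂ _*_ (sym (factor-∉ _ k∉J))
                                                       (sym (factor-∉ _ (k∉I ∘ proj₁ ∘ x∈p─q⁻))) ⟩
    factor J k (prod J xs) * factor (I ─ J) k (prod (I ─ J) xs) ∎

  prod-disjoint : ∀ {I} xs → All (_∉ I) xs → prod I xs ≡ 1#
  prod-disjoint [] [] = refl
  prod-disjoint {I} (k ∷ xs) (k∉I ∷ xs∉I) = trans (factor-∉ _ k∉I) (prod-disjoint xs xs∉I)

  prod-singleton : ∀ {i} xs → Unique xs → i ∈ₗ xs → prod ⁅ i ⁆ xs ≃ var (xᵢ i)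
  prod-singleton {i} (k ∷ xs) (k≢xs ∷ _) (here refl) = begin
    factor ⁅ i ⁆ i (prod ⁅ i ⁆ xs) ≡⟨ factor-∈ _ (x∈⁅x⁆ i) ⟩
    var (xᵢ i) * prod ⁅ i ⁆ xs     ≡⟨ cong (var (xᵢ i) *_) (prod-disjoint xs (All.map (x≢y⇒x∉⁅y⁆ ∘ ≢-sym) k≢xs)) ⟩
    var (xᵢ i) * 1#                ≈⟨ *-identityʳ _ ⟩
    var (xᵢ i)                     ∎
  prod-singleton {i} (k ∷ xs) (k≢xs ∷ unique) (there i∈xs) = begin
    factor ⁅ i ⁆ k (prod ⁅ i ⁆ xs) ≡⟨ factor-∉ _ (x≢y⇒x∉⁅y⁆ (All.lookup k≢xs i∈xs)) ⟩
    prod ⁅ i ⁆ xs                  ≈⟨ prod-singleton xs unique i∈xs ⟩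
    var (xᵢ i)                     ∎

  prodX-split : ∀ {I J} → J ⊆ I → prodX M P I ≃ prodX M P J * prodX M P (I ─ J)
  prodX-split = prod-split (allFin n)

  prodX-remove : ∀ {I i} → i ∈ I → prodX M P I ≃ var (xᵢ i) * prodX M P (I ∖ i)
  prodX-remove {I} {i} i∈I = begin
    prodX M P I                                ≈⟨ prodX-split (λ x∈i → subst (_∈ I) (sym (x∈⁅y⁆⇒x≡y i x∈i)) i∈I) ⟩
    prod ⁅ i ⁆ (allFin n) * prodX M P (I ∖ i)  ≈⟨ *-congʳ (prod-singleton (allFin n) (allFin⁺ n) (∈-allFin i)) ⟩
    var (xᵢ i) * prodX M P (I ∖ i)             ∎

  prodX-insert : ∀ {K j} → j ∉ K → prodX M P (K ∪ ⁅ j ⁆) ≃ var (xᵢ j) * prodX M P K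
  prodX-insert {K} {j} j∉K = begin
    prodX M P (K ∪ ⁅ j ⁆)                   ≈⟨ prodX-remove (q⊆p∪q K ⁅ j ⁆ (x∈⁅x⁆ j)) ⟩
    var (xᵢ j) * prodX M P ((K ∪ ⁅ j ⁆) ∖ j) ≡⟨ cong (λ L → var (xᵢ j) * prodX M P L) ([p∪⁅y⁆]∖y≡p j∉K) ⟩
    var (xᵢ j) * prodX M P K                ∎

  flatSum : Fin n → List (Subset n) → Poly M P
  flatSum i = foldr (λ F acc → termF M P i F (T? (P F)) (i ∈? F) + acc) 0#

  KillsSeparating : Poly M P → Fin n → Fin n → Set
  KillsSeparating Q i j = ∀ G (pG : T (P G)) → i ∈ G → j ∉ G → var (xF G pG) * Q ≃ 0#

  flatSum-agree : ∀ {i j} Q → KillsSeparating Q i j → KillsSeparating Q j i →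
                  ∀ Gs → flatSum i Gs * Q ≃ flatSum j Gs * Q
  flatSum-agree Q _ _ [] = ≈-refl
  flatSum-agree {i} {j} Q kills-ij kills-ji (G ∷ Gs) = begin
    (termF M P i G _ _ + flatSum i Gs) * Q         ≈⟨ distribʳ Q _ _ ⟩
    termF M P i G _ _ * Q + flatSum i Gs * Q       ≈⟨ +-cong (term-agree (T? (P G)) (i ∈? G) (j ∈? G))
                                                             (flatSum-agree Q kills-ij kills-ji Gs) ⟩
    termF M P j G _ _ * Q + flatSum j Gs * Q       ≈⟨ distribʳ Q _ _ ⟨
    (termF M P j G _ _ + flatSum j Gs) * Q         ∎
    where
    term-agree : ∀ pG? i∈? j∈? → termF M P i G pG? i∈? * Q ≃ termF M P j G pG? j∈? * Q
    term-agree (no _)   _         _         = ≈-refl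
    term-agree (yes pG) (yes _)   (yes _)   = ≈-refl
    term-agree (yes pG) (no _)    (no _)    = ≈-refl
    term-agree (yes pG) (yes i∈G) (no j∉G)  = ≈-trans (kills-ij G pG i∈G j∉G) (≈-sym (zeroˡ Q))
    term-agree (yes pG) (no i∉G)  (yes j∈G) = ≈-trans (zeroˡ Q) (≈-sym (kills-ji G pG j∈G i∉G))

  exchange : ∀ {i j} Q → i ≢ j → KillsSeparating Q i j → KillsSeparating Q j i →
             var (xᵢ i) * Q ≃ var (xᵢ j) * Q
  exchange {i} {j} Q i≢j kills-ij kills-ji = +-cancelʳ (Sᵢ * Q) _ _ (begin
    var (xᵢ i) * Q + Sᵢ * Q   ≈⟨ distribʳ Q _ _ ⟨
    linForm M P i * Q         ≈⟨ linear-relation ⟩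
    linForm M P j * Q         ≈⟨ distribʳ Q _ _ ⟩
    var (xᵢ j) * Q + Sⱼ * Q   ≈⟨ +-cong ≈-refl (flatSum-agree Q kills-ij kills-ji (allSubsets n)) ⟨
    var (xᵢ j) * Q + Sᵢ * Q   ∎)
    where
    Sᵢ Sⱼ : Poly M P
    Sᵢ = flatSum i (allSubsets n)
    Sⱼ = flatSum j (allSubsets n)
    linear-relation : linForm M P i * Q ≃ linForm M P j * Q
    linear-relation = x∙y⁻¹≈ε⇒x≈y _ _ (begin
      linForm M P i * Q + - (linForm M P j * Q) ≈⟨ [y-z]x≈yx-zx Q _ _ ⟨
      (linForm M P i + - linForm M P j) * Q     ≈⟨ *-congʳ (gen≈0 (gen-lin i j i≢j)) ⟩
      0# * Q                                    ≈⟨ zeroˡ Q ⟩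
      0#                                        ∎)

  module Vanishing (S : Subset n) (flat : IsFlat M S) (X : Poly M P)
                   (spanning : ∀ J → Independent M J → closure M J ≡ S → prodX M P J ≃ 0#)
                   (separating : ∀ K → suc ∣ K ∣ ≡ rk S → ∀ {i j} → i ∈ S → j ∈ S →
                                 KillsSeparating (prodX M P K * X) i j)
                   where
    open Rank M

    swap-invariant : ∀ J {i j} → J ⊆ S → ∣ J ∣ ≡ rk S → i ∈ J → j ∈ S → j ∉ J →
                     prodX M P J * X ≃ prodX M P ((J ∖ i) ∪ ⁅ j ⁆) * X
    swap-invariant J {i} {j} J⊆S size i∈J j∈S j∉J = begin
      prodX M P J * X                          ≈⟨ *-congʳ (prodX-remove i∈J) ⟩
      (var (xᵢ i) * prodX M P (J ∖ i)) * X     ≈⟨ *-assoc _ _ _ ⟩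
      var (xᵢ i) * Q                           ≈⟨ exchange Q i≢j (separating _ size′ i∈S j∈S)
                                                                  (separating _ size′ j∈S i∈S) ⟩
      var (xᵢ j) * Q                           ≈⟨ *-assoc _ _ _ ⟨
      (var (xᵢ j) * prodX M P (J ∖ i)) * X     ≈⟨ *-congʳ (prodX-insert (j∉J ∘ proj₁ ∘ x∈p∖y⁻)) ⟨
      prodX M P ((J ∖ i) ∪ ⁅ j ⁆) * X          ∎
      where
      Q : Poly M P
      Q = prodX M P (J ∖ i) * X
      i∈S : i ∈ S
      i∈S = J⊆S i∈J
      i≢j : i ≢ j
      i≢j refl = j∉J i∈J
      size′ : suc ∣ J ∖ i ∣ ≡ rk S
      size′ = trans (∣p∖x∣+1≡∣p∣ J i∈J) size

    -- A set J ⊆ S of size rk S has x_J · X = 0: if J is independent it spans S;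
    -- otherwise exchanges raise its rank, at most `fuel` more times.
    mutual
      basis-vanishes : ∀ fuel J → J ⊆ S → ∣ J ∣ ≡ rk S → rk S ≤ fuel ℕ.+ rk J → prodX M P J * X ≃ 0#
      basis-vanishes fuel J J⊆S size enough with m≤n⇒m<n∨m≡n (rk-bound J)
      ... | inj₁ dependent = dependent-vanishes fuel J J⊆S size enough dependent
      ... | inj₂ independent = begin
        prodX M P J * X ≈⟨ *-congʳ (spanning J independent (closure-spanning flat J⊆S (trans independent size))) ⟩
        0# * X          ≈⟨ zeroˡ X ⟩
        0#              ∎

      dependent-vanishes : ∀ fuel J → J ⊆ S → ∣ J ∣ ≡ rk S → rk S ≤ fuel ℕ.+ rk J → rk J < ∣ J ∣ →
                           prodX M P J * X ≃ 0#
      dependent-vanishes zero J _ size enough dependent =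
        contradiction enough (<⇒≱ (subst (rk J <_) size dependent))
      dependent-vanishes (suc fuel) J J⊆S size enough dependent
        with exchange-step J S (subst (rk J <_) size dependent) dependent
      ... | i , j , i∈J , j∈S , j∉J , gain =
        ≈-trans (swap-invariant J J⊆S size i∈J j∈S j∉J) (basis-vanishes fuel _ J′⊆S size′ enough′)
        where
        J′⊆S : (J ∖ i) ∪ ⁅ j ⁆ ⊆ S
        J′⊆S = p∪⁅y⁆⊆q (J⊆S ∘ proj₁ ∘ x∈p∖y⁻) j∈S
        size′ : ∣ (J ∖ i) ∪ ⁅ j ⁆ ∣ ≡ rk S
        size′ = trans (∣p∪⁅x⁆∣≡∣p∣+1 (J ∖ i) (j∉J ∘ proj₁ ∘ x∈p∖y⁻)) (trans (∣p∖x∣+1≡∣p∣ J i∈J) size)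
        enough′ : rk S ≤ fuel ℕ.+ rk ((J ∖ i) ∪ ⁅ j ⁆)
        enough′ = ≤-trans enough (≤-trans (≤-reflexive (sym (+-suc fuel (rk J)))) (+-monoʳ-≤ fuel gain))

    vanishes : ∀ I → I ⊆ S → rk S ≤ ∣ I ∣ → prodX M P I * X ≃ 0#
    vanishes I I⊆S large with subset-of-size I (rk S) large
    ... | J , J⊆I , size = begin
      prodX M P I * X                           ≈⟨ *-congʳ (prodX-split J⊆I) ⟩
      (prodX M P J * prodX M P (I ─ J)) * X     ≈⟨ *-assoc _ _ _ ⟩
      prodX M P J * (prodX M P (I ─ J) * X)     ≈⟨ x∙yz≈y∙xz _ _ _ ⟩
      prodX M P (I ─ J) * (prodX M P J * X)     ≈⟨ *-congˡ (basis-vanishes (rk S) J (I⊆S ∘ J⊆I) size (m≤m+n _ _)) ⟩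
      prodX M P (I ─ J) * 0#                    ≈⟨ zeroʳ _ ⟩
      0#                                        ∎

module Proposition (M : Matroid n) (P : Subset n → Bool) (filter : IsOrderFilter M P) where
  open Matroid M
  open IsOrderFilter filter
  open Rank M
  open Quotient M P

  flat-of : ∀ {F} → T (P F) → IsFlat M F
  flat-of = proj₁ ∘ members _

  -- Part (1), by induction on a bound for rk F.  If I leaves F,
  -- some x_i x_F = 0 is a relation.  If I ⊆ F, the vanishing criterion
  -- applies to S = F and X = x_F.
  mutual
    vanishing-at-flat : ∀ bound F (pF : T (P F)) → rk F < bound → ∀ I → rk F ≤ ∣ I ∣ →
                        prodX M P I * var (xF F pF) ≃ 0#
    vanishing-at-flat zero _ _ () _ _
    vanishing-at-flat (suc bound) F pF rkF<bound I large with ⊆-or-∉ I F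
    ... | inj₂ (i , i∈I , i∉F) = begin
      prodX M P I * var (xF F pF)                      ≈⟨ *-congʳ (prodX-remove i∈I) ⟩
      (var (xᵢ i) * prodX M P (I ∖ i)) * var (xF F pF) ≈⟨ *-assoc _ _ _ ⟩
      var (xᵢ i) * (prodX M P (I ∖ i) * var (xF F pF)) ≈⟨ x∙yz≈y∙xz _ _ _ ⟩
      prodX M P (I ∖ i) * (var (xᵢ i) * var (xF F pF)) ≈⟨ *-congˡ (gen≈0 (gen-out F pF i i∉F)) ⟩
      prodX M P (I ∖ i) * 0#                           ≈⟨ zeroʳ _ ⟩
      0#                                               ∎
    ... | inj₁ I⊆F = Vanishing.vanishes F (flat-of pF) (var (xF F pF)) spanning
                       (separators-vanish bound F pF (≤-pred rkF<bound)) I I⊆F large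
      where
      spanning : ∀ J → Independent M J → closure M J ≡ F → prodX M P J ≃ 0#
      spanning J independent cl≡F = gen≈0 (gen-indep J independent (inj₁ (subst (T ∘ P) (sym cl≡F) pF)))

    -- For ∣K∣ + 1 = rk F, the element x_K · x_F kills every G ∈ P separating
    -- two elements of F: either G ⊂ F, and induction applies as rk G < rk F,
    -- or G and F are incomparable and x_G x_F = 0.
    separators-vanish : ∀ bound F (pF : T (P F)) → rk F ≤ bound → ∀ K → suc ∣ K ∣ ≡ rk F →
                        ∀ {i j} → i ∈ F → j ∈ F → KillsSeparating (prodX M P K * var (xF F pF)) i j
    separators-vanish bound F pF rkF≤bound K size _ j∈F G pG _ j∉G with G ⊆? F
    ... | yes G⊆F = begin
      var (xF G pG) * (prodX M P K * var (xF F pF)) ≈⟨ *-assoc _ _ _ ⟨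
      (var (xF G pG) * prodX M P K) * var (xF F pF) ≈⟨ *-congʳ (*-comm _ _) ⟩
      (prodX M P K * var (xF G pG)) * var (xF F pF) ≈⟨ *-congʳ (vanishing-at-flat bound G pG
                                                          (<-≤-trans rkG<rkF rkF≤bound) K
                                                          (≤-pred (subst (rk G <_) (sym size) rkG<rkF))) ⟩
      0# * var (xF F pF)                            ≈⟨ zeroˡ _ ⟩
      0#                                            ∎
      where
      rkG<rkF : rk G < rk F
      rkG<rkF = flat-rank-< (flat-of pG) G⊆F j∈F j∉G
    ... | no G⊈F = begin
      var (xF G pG) * (prodX M P K * var (xF F pF)) ≈⟨ x∙yz≈y∙xz _ _ _ ⟩
      prodX M P K * (var (xF G pG) * var (xF F pF)) ≈⟨ *-congˡ (gen≈0 (gen-incomp G F pG pF G⊈F λ F⊆G → j∉G (F⊆G j∈F))) ⟩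
      prodX M P K * 0#                              ≈⟨ zeroʳ _ ⟩
      0#                                            ∎

  -- Part (2): the vanishing criterion for S = E and X = 1; a flat G ∈ P is
  -- proper, so rk G < rk E = ∣K∣ + 1 and part (1) kills x_K x_G.
  vanishing : ∀ r → rank M ≡ suc r → ∀ I → suc r ≤ ∣ I ∣ → prodX M P I ≃ 0#
  vanishing r rank≡ I large = begin
    prodX M P I      ≈⟨ *-identityʳ _ ⟨
    prodX M P I * 1# ≈⟨ Vanishing.vanishes ⊤ (λ x x∉E → contradiction ∈⊤ x∉E) 1# spanning separating
                          I ⊆⊤ (subst (_≤ ∣ I ∣) (sym rank≡) large) ⟩
    0#               ∎
    where
    spanning : ∀ J → Independent M J → closure M J ≡ ⊤ → prodX M P J ≃ 0#
    spanning J independent cl≡E = gen≈0 (gen-indep J independent (inj₂ cl≡E))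
    separating : ∀ K → suc ∣ K ∣ ≡ rank M → ∀ {i j} → i ∈ ⊤ → j ∈ ⊤ → KillsSeparating (prodX M P K * 1#) i j
    separating K size _ _ G pG _ _ = begin
      var (xF G pG) * (prodX M P K * 1#) ≈⟨ *-congˡ (*-identityʳ _) ⟩
      var (xF G pG) * prodX M P K        ≈⟨ *-comm _ _ ⟩
      prodX M P K * var (xF G pG)        ≈⟨ vanishing-at-flat (suc (rk G)) G pG (n<1+n _) K
                                              (≤-pred (subst (rk G <_) (sym size) rkG<rkE)) ⟩
      0#                                 ∎
      where
      rkG<rkE : rk G < rank M
      rkG<rkE = let x , x∉G = p≢⊤⇒∃∉ (proj₂ (proj₂ (members G pG))) in flat-rank-< (flat-of pG) ⊆⊤ ∈⊤ x∉G

proposition6p2 : ∀ {n : ℕ} (M : Matroid n) (r : ℕ) → Loopless M → rank M ≡ suc r →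
    (P : Subset n → Bool) → IsOrderFilter M P →
    (I F : Subset n) → (pF : T (P F)) →
    ((Matroid.rk M F ≤ ∣ I ∣ → _≈_ M P (prodX M P I * var (xF F pF)) 0#)
     × (suc r ≤ ∣ I ∣ → _≈_ M P (prodX M P I) 0#))
proposition6p2 M r _ rank≡ P filter I F pF =
  (λ large → vanishing-at-flat (suc (Matroid.rk M F)) F pF (n<1+n _) I large) ,
  (λ large → vanishing r rank≡ I large)
  where open Proposition M P filter
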